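{- Let $n$ and $t$ be positive integers such that either $(n,t)=(4,2)$, or $n\ge4$ and $t\le n-3$. Let $k$ be a nonnegative integer and let $P$ be a path with $n$ vertices. If $T$ is a caterpillar obtained from $P$ by adding $k$ new vertices, each of which is a pendant vertex of $T$ adjacent to an interior (non-end) vertex of $P$, then $T$ is a $(t+k)$-competition graph.
   Context: All graphs are finite and simple. For a positive integer $p$ and a digraph $D=(V,A)$ with $A\subseteq V\times V$ (loops allowed), the $p$-competition graph $C_p(D)$ has vertex set $V$, and distinct $x,y$ are adjacent iff there are $p$ distinct vertices $a_1,\dots,a_p\in V$ with $(x,a_i),(y,a_i)\in A$ for all $i$. A graph is a $p$-competition graph if it equals $C_p(D)$ for some digraph $D$. A caterpillar is a tree with at least $3$ vertices such that removing all its pendant (degree-one) vertices yields a path. -}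

module Defs where

open import Data.Nat using (ℕ; zero; suc; _+_; _<_)
open import Data.Fin using (Fin; toℕ; _↑ˡ_; _↑ʳ_)
open import Data.Product using (Σ; _×_; ∃)
open import Data.Sum using (_⊎_)
open import Function.Definitions using (Injective)
open import Function.Bundles using (_⇔_)
open import Relation.Binary.PropositionalEquality using (_≡_; _≢_)

-- A (simple) graph on vertex set Fin m, given by its adjacency relation.
-- (The graphs we consider are symmetric and irreflexive; only adjacency
-- of distinct vertices matters for p-competition graphs.)
Graph : ℕ → Set₁
Graph m = Fin m → Fin m → Set

Digraph : ℕ → Set₁
Digraph m = Fin m → Fin m → Set

CompetesIn : ∀ {m} → ℕ → Digraph m → Fin m → Fin m → Set
CompetesIn {m} p D x y =
  Σ (Fin p → Fin m) λ a → Injective _≡_ _≡_ a × (∀ i → D x (a i) × D y (a i))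

IsCompGraphOf : ∀ {m} → ℕ → Graph m → Digraph m → Set
IsCompGraphOf p G D = ∀ x y → x ≢ y → (G x y ⇔ CompetesIn p D x y)

IsPCompetitionGraph : ∀ {m} → ℕ → Graph m → Set₁
IsPCompetitionGraph {m} p G = ∃ λ (D : Digraph m) → IsCompGraphOf p G D

-- The tree T on Fin (n + k): vertices i ↑ˡ k (i : Fin n) form the path
-- P = 0 - 1 - ... - (n-1); vertex n ↑ʳ j (j : Fin k) is a new pendant
-- vertex attached to the path vertex att j.
data CatEdge (n k : ℕ) (att : Fin k → Fin n) : Fin (n + k) → Fin (n + k) → Set where
  pathEdge : (i j : Fin n) → suc (toℕ i) ≡ toℕ j → CatEdge n k att (i ↑ˡ k) (j ↑ˡ k)
  pendEdge : (j : Fin k) → CatEdge n k att (att j ↑ˡ k) (n ↑ʳ j)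

CatGraph : (n k : ℕ) → (Fin k → Fin n) → Graph (n + k)
CatGraph n k att x y = CatEdge n k att x y ⊎ CatEdge n k att y x

InteriorAttachment : (n k : ℕ) → (Fin k → Fin n) → Set
InteriorAttachment n k att = ∀ j → (0 < toℕ (att j)) × (suc (toℕ (att j)) < n)

module Submission where

-- Every path vertex u gets arcs to a set A u of path vertices and to all k pendant vertices; a
-- pendant vertex attached at v gets arcs to A v and to the other k − 1 pendant vertices.  Two
-- vertices then have |A u ∩ A w| + k − (number of pendant vertices among them) common
-- out-neighbours, so the caterpillar is the (t + k)-competition graph as soon as |A v| = t + 1 at
-- interior v, |A u ∩ A w| ≥ t along path edges, |A u ∩ A w| < t for non-adjacent path vertices,
-- and |A u ∩ A w| ≤ t when u is interior.
-- For t ≤ n − 3 take for A u the cyclic window {u, …, u + t} of ℤ/n.  By rotation, two windows at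
-- cyclic distance d share as many points as {0, …, t} and the window at d: t + 1 for d = 0, t for
-- d = 1, at most t for d ≠ 0, and at most t − 1 for 2 ≤ d ≤ n − 2, where t ≤ n − 3 leaves two
-- points of {0, …, t} outside the window at d.  The last window is cut down so that the ends of the
-- path do not look adjacent.  For (n, t) = (4, 2) the closed neighbourhoods of the path work.

open import Defs
open import Data.Bool using (Bool; true; false; T; not; _∧_; _∨_; if_then_else_)
open import Data.Bool.Properties using (T-∧; T-∨; ∧-comm; ∧-idem; ∧-identityʳ)
open import Data.Empty using (⊥-elim)
open import Data.Fin using (Fin; zero; suc; toℕ; fromℕ<; punchIn; punchOut; _↑ˡ_; _↑ʳ_; splitAt; join)
open import Data.Fin.Properties
  using ( _≟_; all?; any?; suc-injective; toℕ<n; toℕ-injective; toℕ-fromℕ<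
        ; splitAt-↑ˡ; splitAt-↑ʳ; join-splitAt
        ; punchIn-injective; punchInᵢ≢i; punchOut-injective; punchIn-punchOut)
open import Data.Nat
  using (ℕ; zero; suc; pred; _+_; _∸_; _%_; NonZero; _≤_; _<_; z≤n; s≤s; s≤s⁻¹; z<s; >-nonZero)
open import Data.Nat.Properties hiding (_≟_; suc-injective)
import Data.Nat.Properties as ℕ
open import Data.Nat.DivMod using (m<n⇒m%n≡m; [m+n]%n≡m%n; %-distribˡ-+; m%n%n≡m%n)
open import Data.Nat.Tactic.RingSolver using (solve-∀)
open import Data.Product using (Σ; _×_; _,_; proj₁; proj₂; map)
open import Data.Sum using (_⊎_; inj₁; inj₂; swap)
open import Data.Vec.Functional using (_∷_)
open import Function using (_∘_; id; _⇔_; mk⇔; Equivalence)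
open import Function.Definitions using (Injective)
open import Relation.Binary.Definitions using (tri<; tri≈; tri>)
open import Relation.Binary.PropositionalEquality
open import Relation.Nullary using (Dec; yes; no; ¬_; does; ¬?; _×-dec_; _→-dec_)
open import Relation.Nullary.Decidable using (dec-true; dec-false; from-yes)

bit : Bool → ℕ
bit true  = 1
bit false = 0

bit-mono : ∀ {a b} → (T a → T b) → bit a ≤ bit b
bit-mono {false}         _   = z≤n
bit-mono {true}  {true}  _   = ≤-refl
bit-mono {true}  {false} a⇒b = ⊥-elim (a⇒b _)

count : ∀ {m} → (Fin m → Bool) → ℕ
count {zero}  P = 0
count {suc m} P = bit (P zero) + count (P ∘ suc)

Distinct : ∀ {m} → ℕ → (Fin m → Set) → Set
Distinct {m} p S = Σ (Fin p → Fin m) λ f → Injective _≡_ _≡_ f × (∀ i → S (f i))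

distinct-map : ∀ {m p} {S S′ : Fin m → Set} → (∀ a → S a → S′ a) → Distinct p S → Distinct p S′
distinct-map S⇒S′ (f , inj , s) = f , inj , λ i → S⇒S′ (f i) (s i)

module _ {m} (S : Fin (suc m) → Set) where

  distinct-suc : ∀ {p} → Distinct p (S ∘ suc) → Distinct p S
  distinct-suc (f , inj , s) = suc ∘ f , inj ∘ suc-injective , s

  distinct-cons : ∀ {p} → S zero → Distinct p (S ∘ suc) → Distinct (suc p) S
  distinct-cons s₀ (f , inj , s) = zero ∷ suc ∘ f , inj′ , λ { zero → s₀ ; (suc i) → s i }
    where
    inj′ : Injective _≡_ _≡_ (zero ∷ suc ∘ f)
    inj′ {zero}  {zero}  _  = refl
    inj′ {suc i} {suc j} eq = cong suc (inj (suc-injective eq))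

  distinct-unsuc : ∀ {p} ((f , _) : Distinct p S) → (∀ i → zero ≢ f i) → Distinct p (S ∘ suc)
  distinct-unsuc (f , inj , s) f≢0 =
    (λ i → punchOut (f≢0 i)) ,
    inj ∘ punchOut-injective (f≢0 _) (f≢0 _) ,
    (λ i → subst S (sym (punchIn-punchOut (f≢0 i))) (s i))

  distinct-drop : ∀ {p} ((f , _) : Distinct (suc p) S) i → f i ≡ zero → Distinct p (S ∘ suc)
  distinct-drop (f , inj , s) i fi≡0 =
    distinct-unsuc (f ∘ punchIn i , punchIn-injective i _ _ ∘ inj , s ∘ punchIn i)
      (λ j 0≡f[j] → punchInᵢ≢i i j (inj (trans (sym 0≡f[j]) (sym fi≡0))))

≤count⇒distinct : ∀ {m} p (P : Fin m → Bool) → p ≤ count P → Distinct p (T ∘ P)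
≤count⇒distinct zero P _ = (λ ()) , (λ { {()} }) , (λ ())
≤count⇒distinct {suc m} (suc p) P p≤count with P zero in P₀
... | false = distinct-suc (T ∘ P) (≤count⇒distinct (suc p) (P ∘ suc) p≤count)
... | true  = distinct-cons (T ∘ P) (subst T (sym P₀) _) (≤count⇒distinct p (P ∘ suc) (s≤s⁻¹ p≤count))

distinct⇒≤count : ∀ {m p} (P : Fin m → Bool) → Distinct p (T ∘ P) → p ≤ count P
distinct⇒≤count {p = zero} P _ = z≤n
distinct⇒≤count {zero} {suc p} P (f , _) with f zero
... | ()
distinct⇒≤count {suc m} {suc p} P d@(f , _ , s) with any? (λ i → f i ≟ zero)
... | no ∄i =
  ≤-trans (distinct⇒≤count (P ∘ suc) (distinct-unsuc (T ∘ P) d (λ i 0≡fi → ∄i (i , sym 0≡fi))))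
          (m≤n+m _ (bit (P zero)))
... | yes (i , fi≡0) with P zero in P₀
...   | true  = s≤s (distinct⇒≤count (P ∘ suc) (distinct-drop (T ∘ P) d i fi≡0))
...   | false = ⊥-elim (subst T P₀ (subst (T ∘ P) fi≡0 (s i)))

count-cong : ∀ {m} {P Q : Fin m → Bool} → (∀ i → P i ≡ Q i) → count P ≡ count Q
count-cong {zero}  _   = refl
count-cong {suc m} P≡Q = cong₂ _+_ (cong bit (P≡Q zero)) (count-cong (P≡Q ∘ suc))

count-true : ∀ m → count {m} (λ _ → true) ≡ m
count-true zero    = refl
count-true (suc m) = cong suc (count-true m)

count-false : ∀ m → count {m} (λ _ → false) ≡ 0
count-false zero    = refl
count-false (suc m) = count-false m

count-mono : ∀ {m} {P Q : Fin m → Bool} → (∀ i → T (P i) → T (Q i)) → count P ≤ count Q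
count-mono {zero}  _   = z≤n
count-mono {suc m} P⊆Q = +-mono-≤ (bit-mono (P⊆Q zero)) (count-mono (P⊆Q ∘ suc))

count-<-mono : ∀ {m} {P Q : Fin m → Bool} → (∀ i → T (P i) → T (Q i)) →
               (i : Fin m) → T (Q i) → ¬ T (P i) → count P < count Q
count-<-mono {P = P} {Q} P⊆Q zero Qi ¬Pi with P zero | Q zero
... | false | true = s≤s (count-mono (P⊆Q ∘ suc))
... | true  | _    = ⊥-elim (¬Pi _)
count-<-mono P⊆Q (suc i) Qi ¬Pi = +-mono-≤-< (bit-mono (P⊆Q zero)) (count-<-mono (P⊆Q ∘ suc) i Qi ¬Pi)

count-++ : ∀ n {k} (P : Fin (n + k) → Bool) → count P ≡ count (P ∘ (_↑ˡ k)) + count (P ∘ (n ↑ʳ_))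
count-++ zero    P = refl
count-++ (suc n) P =
  trans (cong (bit (P zero) +_) (count-++ n (P ∘ suc))) (sym (+-assoc (bit (P zero)) _ _))

infix 4 _≢ᵇ_
_≢ᵇ_ : ∀ {m} → Fin m → Fin m → Bool
i ≢ᵇ j = not (does (i ≟ j))

count-remove : ∀ {m} (j : Fin m) (Q : Fin m → Bool) → count (λ i → (j ≢ᵇ i) ∧ Q i) + bit (Q j) ≡ count Q
count-remove zero    Q = +-comm (count (Q ∘ suc)) (bit (Q zero))
count-remove (suc j) Q =
  trans (+-assoc (bit (Q zero)) _ _) (cong (bit (Q zero) +_) (count-remove j (Q ∘ suc)))

count-≢ᵇ : ∀ {m} (j : Fin m) → count (j ≢ᵇ_) + 1 ≡ m
count-≢ᵇ {m} j = begin
  count (j ≢ᵇ_) + 1                       ≡⟨ cong (_+ 1) (count-cong {m} (λ i → ∧-identityʳ (j ≢ᵇ i))) ⟨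
  count (λ i → (j ≢ᵇ i) ∧ true) + 1       ≡⟨ count-remove j (λ _ → true) ⟩
  count {m} (λ _ → true)                  ≡⟨ count-true m ⟩
  m                                       ∎
  where open ≡-Reasoning

count-≢ᵇ₂ : ∀ {m} {j j′ : Fin m} → j ≢ j′ → count (λ i → (j ≢ᵇ i) ∧ (j′ ≢ᵇ i)) + 2 ≡ m
count-≢ᵇ₂ {m} {j} {j′} j≢j′ = begin
  count Q₂ + 2                  ≡⟨ +-assoc (count Q₂) 1 1 ⟨
  count Q₂ + 1 + 1              ≡⟨ cong (λ b → count Q₂ + bit (not b) + 1) (dec-false (j′ ≟ j) (j≢j′ ∘ sym)) ⟨
  count Q₂ + bit (j′ ≢ᵇ j) + 1  ≡⟨ cong (_+ 1) (count-remove j (j′ ≢ᵇ_)) ⟩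
  count (j′ ≢ᵇ_) + 1            ≡⟨ count-≢ᵇ j′ ⟩
  m                             ∎
  where
  open ≡-Reasoning
  Q₂ = λ i → (j ≢ᵇ i) ∧ (j′ ≢ᵇ i)

countBelow : ℕ → (ℕ → Bool) → ℕ
countBelow m Q = count {m} (Q ∘ toℕ)

countBelow-cong : ∀ m {Q R : ℕ → Bool} → (∀ b → b < m → Q b ≡ R b) → countBelow m Q ≡ countBelow m R
countBelow-cong m Q≡R = count-cong (λ i → Q≡R (toℕ i) (toℕ<n i))

countBelow-+ : ∀ a c (Q : ℕ → Bool) → countBelow (a + c) Q ≡ countBelow a Q + countBelow c (λ i → Q (a + i))
countBelow-+ zero    c Q = refl
countBelow-+ (suc a) c Q =
  trans (cong (bit (Q 0) +_) (countBelow-+ a c (Q ∘ suc))) (sym (+-assoc (bit (Q 0)) _ _))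

countBelow-≤? : ∀ {m t} → t < m → (R : ℕ → Bool) →
                countBelow m (λ b → does (b ≤? t) ∧ R b) ≡ countBelow (suc t) R
countBelow-≤? {m} {t} t<m R = begin
  countBelow m F                                              ≡⟨ cong (λ m → countBelow m F) (m+[n∸m]≡n t<m) ⟨
  countBelow (suc t + r) F                                    ≡⟨ countBelow-+ (suc t) r F ⟩
  countBelow (suc t) F + countBelow r (λ i → F (suc t + i))   ≡⟨ cong₂ _+_ (countBelow-cong (suc t) below)
                                                                             (countBelow-cong r above) ⟩
  countBelow (suc t) R + count {r} (λ _ → false)              ≡⟨ cong (countBelow (suc t) R +_) (count-false r) ⟩
  countBelow (suc t) R + 0                                    ≡⟨ +-identityʳ _ ⟩
  countBelow (suc t) R                                        ∎
  where
  open ≡-Reasoning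
  F = λ b → does (b ≤? t) ∧ R b
  r = m ∸ suc t
  below : ∀ b → b < suc t → F b ≡ R b
  below b b<1+t = cong (_∧ R b) (dec-true (b ≤? t) (s≤s⁻¹ b<1+t))
  above : ∀ i → i < r → F (suc t + i) ≡ false
  above i _ = cong (_∧ R (suc t + i)) (dec-false (suc t + i ≤? t) (<⇒≱ (m≤m+n (suc t) i)))

[m%n+o]%n≡[m+o]%n : ∀ m o n .⦃ _ : NonZero n ⦄ → (m % n + o) % n ≡ (m + o) % n
[m%n+o]%n≡[m+o]%n m o n = begin
  (m % n + o) % n           ≡⟨ %-distribˡ-+ (m % n) o n ⟩
  (m % n % n + o % n) % n   ≡⟨ cong (λ x → (x + o % n) % n) (m%n%n≡m%n m n) ⟩
  (m % n + o % n) % n       ≡⟨ %-distribˡ-+ m o n ⟨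
  (m + o) % n               ∎
  where open ≡-Reasoning

countBelow-rotate : ∀ {N s} .⦃ _ : NonZero N ⦄ → s ≤ N → (Q : ℕ → Bool) →
                    countBelow N (λ b → Q ((b + s) % N)) ≡ countBelow N Q
countBelow-rotate {N} {s} s≤N Q = begin
  countBelow N R                                      ≡⟨ cong (λ m → countBelow m R) r+s≡N ⟨
  countBelow (r + s) R                                ≡⟨ countBelow-+ r s R ⟩
  countBelow r R + countBelow s (λ i → R (r + i))     ≡⟨ cong₂ _+_ (countBelow-cong r front)
                                                                     (countBelow-cong s back) ⟩
  countBelow r (λ b → Q (s + b)) + countBelow s Q     ≡⟨ +-comm (countBelow r (λ b → Q (s + b))) _ ⟩
  countBelow s Q + countBelow r (λ b → Q (s + b))     ≡⟨ countBelow-+ s r Q ⟨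
  countBelow (s + r) Q                                ≡⟨ cong (λ m → countBelow m Q) (m+[n∸m]≡n s≤N) ⟩
  countBelow N Q                                      ∎
  where
  open ≡-Reasoning
  R = λ b → Q ((b + s) % N)
  r = N ∸ s
  r+s≡N : r + s ≡ N
  r+s≡N = m∸n+n≡m s≤N
  front : ∀ b → b < r → R b ≡ Q (s + b)
  front b b<r = cong Q (trans (m<n⇒m%n≡m (subst (b + s <_) r+s≡N (+-monoˡ-< s b<r))) (+-comm b s))
  back : ∀ i → i < s → R (r + i) ≡ Q i
  back i i<s = cong Q (begin
    (r + i + s) % N   ≡⟨ cong (_% N) (trans (+-assoc r i s) (cong (r +_) (+-comm i s))) ⟩
    (r + (s + i)) % N ≡⟨ cong (_% N) (trans (sym (+-assoc r s i)) (trans (cong (_+ i) r+s≡N) (+-comm N i))) ⟩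
    (i + N) % N       ≡⟨ [m+n]%n≡m%n i N ⟩
    i % N             ≡⟨ m<n⇒m%n≡m (<-≤-trans i<s s≤N) ⟩
    i                 ∎)

countBelow-<-mono : ∀ {m h} {P Q : ℕ → Bool} → (∀ b → T (P b) → T (Q b)) →
                    h < m → T (Q h) → ¬ T (P h) → countBelow m P < countBelow m Q
countBelow-<-mono {P = P} {Q} P⊆Q h<m Qh ¬Ph =
  count-<-mono (λ i → P⊆Q (toℕ i)) (fromℕ< h<m)
    (subst (T ∘ Q) (sym (toℕ-fromℕ< h<m)) Qh) (¬Ph ∘ subst (T ∘ P) (toℕ-fromℕ< h<m))

countBelow-hole : ∀ {m h} (Q : ℕ → Bool) → h < m → Q h ≡ false → countBelow m Q < m
countBelow-hole {m} Q h<m Qh≡false =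
  subst (countBelow m Q <_) (count-true m) (countBelow-<-mono (λ _ _ → _) h<m _ (subst T Qh≡false))

countBelow-holes : ∀ {m h h′} (Q : ℕ → Bool) → h < m → h′ < m → h ≢ h′ →
                   Q h ≡ false → Q h′ ≡ false → suc (countBelow m Q) < m
countBelow-holes {m} {h} {h′} Q h<m h′<m h≢h′ Qh≡false Qh′≡false =
  ≤-trans (s≤s (countBelow-<-mono {Q = Q+h} (λ _ → Equivalence.from T-∨ ∘ inj₁) h<m Q+h[h] (subst T Qh≡false)))
          (countBelow-hole Q+h h′<m Q+h[h′])
  where
  Q+h : ℕ → Bool
  Q+h b = Q b ∨ does (b ℕ.≟ h)
  Q+h[h] : T (Q+h h)
  Q+h[h] = Equivalence.from T-∨ (inj₂ (subst T (sym (dec-true (h ℕ.≟ h) refl)) _))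
  Q+h[h′] : Q+h h′ ≡ false
  Q+h[h′] = cong₂ _∨_ Qh′≡false (dec-false (h′ ℕ.≟ h) (h≢h′ ∘ sym))

competes⇔≤count : ∀ {m p} (D : Fin m → Fin m → Bool) x y →
                  CompetesIn p (λ u v → T (D u v)) x y ⇔ p ≤ count (λ a → D x a ∧ D y a)
competes⇔≤count D x y = mk⇔
  (distinct⇒≤count P ∘ distinct-map {S = Both} (λ _ → Equivalence.from T-∧))
  (distinct-map {S′ = Both} (λ _ → Equivalence.to T-∧) ∘ ≤count⇒distinct _ P)
  where
  P = λ a → D x a ∧ D y a
  Both = λ a → T (D x a) × T (D y a)

Interior : ℕ → ℕ → Set
Interior n v = 0 < v × suc v < n

common : ∀ {n} → (Fin n → Fin n → Bool) → Fin n → Fin n → ℕ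
common A u w = count (λ a → A u a ∧ A w a)

common-comm : ∀ {n} (A : Fin n → Fin n → Bool) u w → common A u w ≡ common A w u
common-comm A u w = count-cong (λ a → ∧-comm (A u a) (A w a))

record Admissible (n t : ℕ) (A : Fin n → Fin n → Bool) : Set where
  field
    interior-size   : ∀ v → Interior n (toℕ v) → count (A v) ≡ suc t
    adjacent-common : ∀ u w → suc (toℕ u) ≡ toℕ w → t ≤ common A u w
    distant-common  : ∀ u w → u ≢ w → suc (toℕ u) ≢ toℕ w → suc (toℕ w) ≢ toℕ u → common A u w < t
    interior-common : ∀ v w → Interior n (toℕ v) → w ≢ v → common A v w ≤ t

module PendantExtension {n t k} {A : Fin n → Fin n → Bool} (adm : Admissible n t A)
                        (att : Fin k → Fin n) (att-interior : InteriorAttachment n k att) where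
  open Admissible adm

  Vertex : Set
  Vertex = Fin n ⊎ Fin k

  anchor : Vertex → Fin n
  anchor (inj₁ u) = u
  anchor (inj₂ j) = att j

  avoids : Vertex → Fin k → Bool
  avoids (inj₁ _) _ = true
  avoids (inj₂ i) j = i ≢ᵇ j

  arc : Vertex → Vertex → Bool
  arc x (inj₁ a) = A (anchor x) a
  arc x (inj₂ j) = avoids x j

  digraph : Digraph (n + k)
  digraph x a = T (arc (splitAt n x) (splitAt n a))

  outCommon : Vertex → Vertex → ℕ
  outCommon x y = common A (anchor x) (anchor y) + count (λ j → avoids x j ∧ avoids y j)

  count-arc≡outCommon : ∀ x y → count (λ a → arc (splitAt n x) (splitAt n a) ∧ arc (splitAt n y) (splitAt n a))
                                ≡ outCommon (splitAt n x) (splitAt n y)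
  count-arc≡outCommon x y = trans (count-++ n _) (cong₂ _+_
    (count-cong (λ a → cong both (splitAt-↑ˡ n a k)))
    (count-cong (λ j → cong both (splitAt-↑ʳ n k j))))
    where
    both : Vertex → Bool
    both z = arc (splitAt n x) z ∧ arc (splitAt n y) z

  outCommon-comm : ∀ x y → outCommon x y ≡ outCommon y x
  outCommon-comm x y =
    cong₂ _+_ (common-comm A (anchor x) (anchor y)) (count-cong (λ j → ∧-comm (avoids x j) (avoids y j)))

  outCommon-path : ∀ u w → outCommon (inj₁ u) (inj₁ w) ≡ common A u w + k
  outCommon-path u w = cong (common A u w +_) (count-true k)

  outCommon-adjacent : ∀ u w → suc (toℕ u) ≡ toℕ w → t + k ≤ outCommon (inj₁ u) (inj₁ w)
  outCommon-adjacent u w adj =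
    subst (t + k ≤_) (sym (outCommon-path u w)) (+-monoˡ-≤ k (adjacent-common u w adj))

  outCommon-pendant : ∀ j → outCommon (inj₁ (att j)) (inj₂ j) ≡ t + k
  outCommon-pendant j = begin
    common A v v + count (j ≢ᵇ_)   ≡⟨ cong (_+ count (j ≢ᵇ_)) (trans (count-cong (λ a → ∧-idem (A v a)))
                                                                      (interior-size v (att-interior j))) ⟩
    suc t + count (j ≢ᵇ_)          ≡⟨ +-suc t _ ⟨
    t + suc (count (j ≢ᵇ_))        ≡⟨ cong (t +_) (trans (+-comm 1 _) (count-≢ᵇ j)) ⟩
    t + k                          ∎
    where
    open ≡-Reasoning
    v = att j

  outCommon-distant : ∀ u w → u ≢ w → suc (toℕ u) ≢ toℕ w → suc (toℕ w) ≢ toℕ u →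
                      outCommon (inj₁ u) (inj₁ w) < t + k
  outCommon-distant u w u≢w ¬uw ¬wu =
    subst (_< t + k) (sym (outCommon-path u w)) (+-monoˡ-< k (distant-common u w u≢w ¬uw ¬wu))

  outCommon-path-pendant : ∀ u j → u ≢ att j → outCommon (inj₁ u) (inj₂ j) < t + k
  outCommon-path-pendant u j u≢v =
    +-mono-≤-< (subst (_≤ t) (common-comm A (att j) u) (interior-common (att j) u (att-interior j) u≢v))
               (subst (count (j ≢ᵇ_) <_) (count-≢ᵇ j) (m<m+n _ 0<1+n))

  outCommon-pendants : ∀ j j′ → j ≢ j′ → outCommon (inj₂ j) (inj₂ j′) < t + k
  outCommon-pendants j j′ j≢j′ = begin-strict
    common A v v′ + E     ≤⟨ +-monoˡ-≤ E common≤1+t ⟩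
    suc t + E             ≡⟨ +-suc t E ⟨
    t + suc E             <⟨ +-monoʳ-< t (subst (suc E <_) (trans (+-comm 2 E) (count-≢ᵇ₂ j≢j′)) ≤-refl) ⟩
    t + k                 ∎
    where
    open ≤-Reasoning
    v = att j
    v′ = att j′
    E = count (λ i → (j ≢ᵇ i) ∧ (j′ ≢ᵇ i))
    common≤1+t : common A v v′ ≤ suc t
    common≤1+t = subst (common A v v′ ≤_) (interior-size v (att-interior j))
                   (count-mono {n} (λ a → proj₁ ∘ Equivalence.to T-∧))

  edge⇒competes : ∀ {x y} → CatEdge n k att x y → t + k ≤ outCommon (splitAt n x) (splitAt n y)
  edge⇒competes (pathEdge u w adj) rewrite splitAt-↑ˡ n u k | splitAt-↑ˡ n w k = outCommon-adjacent u w adj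
  edge⇒competes (pendEdge j) rewrite splitAt-↑ˡ n (att j) k | splitAt-↑ʳ n k j =
    ≤-reflexive (sym (outCommon-pendant j))

  competes⇒edge : ∀ x y → x ≢ y → t + k ≤ outCommon x y → CatGraph n k att (join n k x) (join n k y)
  competes⇒edge (inj₁ u) (inj₁ w) x≢y t+k≤ with suc (toℕ u) ℕ.≟ toℕ w | suc (toℕ w) ℕ.≟ toℕ u
  ... | yes adj | _       = inj₁ (pathEdge u w adj)
  ... | no _    | yes adj = inj₂ (pathEdge w u adj)
  ... | no ¬uw  | no ¬wu  = ⊥-elim (<⇒≱ (outCommon-distant u w (x≢y ∘ cong inj₁) ¬uw ¬wu) t+k≤)
  competes⇒edge (inj₁ u) (inj₂ j) _ t+k≤ with u ≟ att j
  ... | yes refl = inj₁ (pendEdge j)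
  ... | no u≢v   = ⊥-elim (<⇒≱ (outCommon-path-pendant u j u≢v) t+k≤)
  competes⇒edge (inj₂ j) (inj₁ u) x≢y t+k≤ =
    swap (competes⇒edge (inj₁ u) (inj₂ j) (x≢y ∘ sym)
            (subst (t + k ≤_) (outCommon-comm (inj₂ j) (inj₁ u)) t+k≤))
  competes⇒edge (inj₂ j) (inj₂ j′) x≢y t+k≤ = ⊥-elim (<⇒≱ (outCommon-pendants j j′ (x≢y ∘ cong inj₂)) t+k≤)

  isCompGraph : IsCompGraphOf (t + k) (CatGraph n k att) digraph
  isCompGraph x y x≢y = mk⇔
    (λ xy → from (subst (t + k ≤_) (sym (count-arc≡outCommon x y)) (edge⇒competes′ xy)))
    (λ c → subst₂ (CatGraph n k att) (join-splitAt n k x) (join-splitAt n k y)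
             (competes⇒edge (splitAt n x) (splitAt n y) (x≢y ∘ splitAt-injective)
               (subst (t + k ≤_) (count-arc≡outCommon x y) (to c))))
    where
    open Equivalence (competes⇔≤count (λ u v → arc (splitAt n u) (splitAt n v)) x y)
    edge⇒competes′ : CatGraph n k att x y → t + k ≤ outCommon (splitAt n x) (splitAt n y)
    edge⇒competes′ (inj₁ xy) = edge⇒competes xy
    edge⇒competes′ (inj₂ yx) = subst (t + k ≤_) (outCommon-comm (splitAt n y) (splitAt n x)) (edge⇒competes yx)
    splitAt-injective : splitAt n x ≡ splitAt n y → x ≡ y
    splitAt-injective eq = trans (sym (join-splitAt n k x)) (trans (cong (join n k) eq) (join-splitAt n k y))

admissible⇒competition : ∀ {n t k A} → Admissible n t A → (att : Fin k → Fin n) → InteriorAttachment n k att →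
                         IsPCompetitionGraph (t + k) (CatGraph n k att)
admissible⇒competition adm att att-interior = digraph , isCompGraph
  where open PendantExtension adm att att-interior

module CyclicWindows (L t : ℕ) where

  N : ℕ
  N = suc L

  -- For s ≤ N, window s is the cyclic interval {s, s + 1, …, s + t} of ℤ/N.
  window : ℕ → ℕ → Bool
  window s a = does ((a + (N ∸ s)) % N ≤? t)

  cap : ℕ → ℕ → ℕ
  cap s s′ = countBelow N (λ a → window s a ∧ window s′ a)

  shared : ℕ → ℕ
  shared d = countBelow (suc t) (window d)

  cap-comm : ∀ s s′ → cap s s′ ≡ cap s′ s
  cap-comm s s′ = countBelow-cong N (λ a _ → ∧-comm (window s a) (window s′ a))

  window-rotate : ∀ s d b → s + d ≤ N → window (s + d) ((b + s) % N) ≡ window d b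
  window-rotate s d b s+d≤N = cong (λ x → does (x ≤? t)) (begin
    ((b + s) % N + (N ∸ (s + d))) % N   ≡⟨ [m%n+o]%n≡[m+o]%n (b + s) _ N ⟩
    (b + s + (N ∸ (s + d))) % N         ≡⟨ cong (_% N) (+-assoc b s _) ⟩
    (b + (s + (N ∸ (s + d)))) % N       ≡⟨ cong (λ x → (b + x) % N) (+-∸-assoc s s+d≤N) ⟨
    (b + (s + N ∸ (s + d))) % N         ≡⟨ cong (λ x → (b + x) % N) ([m+n]∸[m+o]≡n∸o s N d) ⟩
    (b + (N ∸ d)) % N                   ∎)
    where open ≡-Reasoning

  window-offset : ∀ {d i} → d ≤ N → i < N → window d (d + i) ≡ does (i ≤? t)
  window-offset {d} {i} d≤N i<N = cong (λ x → does (x ≤? t)) (begin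
    (d + i + (N ∸ d)) % N     ≡⟨ cong (_% N) (trans (cong (_+ (N ∸ d)) (+-comm d i)) (+-assoc i d _)) ⟩
    (i + (d + (N ∸ d))) % N   ≡⟨ cong (λ x → (i + x) % N) (m+[n∸m]≡n d≤N) ⟩
    (i + N) % N               ≡⟨ [m+n]%n≡m%n i N ⟩
    i % N                     ≡⟨ m<n⇒m%n≡m i<N ⟩
    i                         ∎)
    where open ≡-Reasoning

  window-∉ : ∀ {d b} → b < d → d ≤ N → t + d < b + N → window d b ≡ false
  window-∉ {d} {b} b<d d≤N t+d<b+N =
    trans (cong (λ x → does (x ≤? t)) (m<n⇒m%n≡m small)) (dec-false (_ ≤? t) (<⇒≱ large))
    where
    d+[N∸d]≡N : d + (N ∸ d) ≡ N
    d+[N∸d]≡N = m+[n∸m]≡n d≤N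
    small : b + (N ∸ d) < N
    small = subst (b + (N ∸ d) <_) d+[N∸d]≡N (+-monoˡ-< (N ∸ d) b<d)
    b+N≡b+[N∸d]+d : b + N ≡ b + (N ∸ d) + d
    b+N≡b+[N∸d]+d = trans (cong (b +_) (trans (sym d+[N∸d]≡N) (+-comm d _))) (sym (+-assoc b _ d))
    large : t < b + (N ∸ d)
    large = +-cancelʳ-< d t (b + (N ∸ d)) (subst (t + d <_) b+N≡b+[N∸d]+d t+d<b+N)

  cap-rotate : ∀ s d → t < N → s + d ≤ N → cap s (s + d) ≡ shared d
  cap-rotate s d t<N s+d≤N = begin
    cap s (s + d)
      ≡⟨ countBelow-rotate s≤N (λ a → window s a ∧ window (s + d) a) ⟨
    countBelow N (λ b → window s (r b) ∧ window (s + d) (r b))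
      ≡⟨ countBelow-cong N (λ b b<N → cong₂ _∧_ (start b b<N) (window-rotate s d b s+d≤N)) ⟩
    countBelow N (λ b → does (b ≤? t) ∧ window d b)
      ≡⟨ countBelow-≤? t<N (window d) ⟩
    shared d
      ∎
    where
    open ≡-Reasoning
    s≤N : s ≤ N
    s≤N = m+n≤o⇒m≤o s s+d≤N
    r : ℕ → ℕ
    r b = (b + s) % N
    start : ∀ b → b < N → window s (r b) ≡ does (b ≤? t)
    start b b<N = begin
      window s (r b)        ≡⟨ cong (λ x → window x (r b)) (+-identityʳ s) ⟨
      window (s + 0) (r b)  ≡⟨ window-rotate s 0 b (subst (_≤ N) (sym (+-identityʳ s)) s≤N) ⟩
      window 0 b            ≡⟨ window-offset z≤n b<N ⟩
      does (b ≤? t)         ∎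

  cap-∸ : ∀ {s s′} → t < N → s ≤ s′ → s′ ≤ N → cap s s′ ≡ shared (s′ ∸ s)
  cap-∸ {s} {s′} t<N s≤s′ s′≤N =
    trans (cong (cap s) (sym s+d≡s′)) (cap-rotate s (s′ ∸ s) t<N (subst (_≤ N) (sym s+d≡s′) s′≤N))
    where
    s+d≡s′ : s + (s′ ∸ s) ≡ s′
    s+d≡s′ = m+[n∸m]≡n s≤s′

  shared-0 : t < N → shared 0 ≡ suc t
  shared-0 t<N = trans (countBelow-cong (suc t) inside) (count-true (suc t))
    where
    inside : ∀ b → b < suc t → window 0 b ≡ true
    inside b b<1+t = trans (window-offset z≤n (<-≤-trans b<1+t t<N)) (dec-true (b ≤? t) (s≤s⁻¹ b<1+t))

  shared-1 : t < N → t ≤ shared 1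
  shared-1 t<N = begin
    t                                       ≡⟨ count-true t ⟨
    count {t} (λ _ → true)                  ≡⟨ countBelow-cong t inside ⟨
    countBelow t (λ i → window 1 (suc i))   ≤⟨ m≤n+m _ _ ⟩
    shared 1                               ∎
    where
    open ≤-Reasoning
    inside : ∀ i → i < t → window 1 (suc i) ≡ true
    inside i i<t = trans (window-offset (<-≤-trans z<s t<N) (<-trans i<t t<N)) (dec-true (i ≤? t) (<⇒≤ i<t))

  shared-≤ : ∀ {d} → 0 < d → d < N → 2 + t ≤ N → shared d ≤ t
  shared-≤ {suc e} _ d<N 2+t≤N with suc e ≤? t
  ... | yes d≤t = s≤s⁻¹ (countBelow-hole (window (suc e)) (s≤s (<⇒≤ d≤t)) (window-∉ ≤-refl (<⇒≤ d<N) gap))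
    where
    reorder : ∀ t e → e + (2 + t) ≡ suc (t + suc e)
    reorder = solve-∀
    gap : t + suc e < e + N
    gap = subst (_≤ e + N) (reorder t e) (+-monoʳ-≤ e 2+t≤N)
  ... | no  d≰t =
    s≤s⁻¹ (countBelow-hole (window (suc e)) ≤-refl (window-∉ (≰⇒> d≰t) (<⇒≤ d<N) (+-monoʳ-< t d<N)))

  shared-<-at : ∀ {d} h → suc h < d → d ≤ N → suc h ≤ t → t + d < h + N → shared d < t
  shared-<-at {d} h 1+h<d d≤N 1+h≤t gap = s≤s⁻¹ (countBelow-holes (window d)
    (s≤s (≤-trans (n≤1+n h) 1+h≤t)) (s≤s 1+h≤t) (<⇒≢ (n<1+n h))
    (window-∉ (<-trans (n<1+n h) 1+h<d) d≤N gap) (window-∉ 1+h<d d≤N (m≤n⇒m≤1+n gap)))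

  shared-< : ∀ {d} → 2 ≤ d → 2 + d ≤ N → 3 + t ≤ N → 0 < t → shared d < t
  shared-< {d@(suc (suc e))} (s≤s (s≤s z≤n)) 2+d≤N 3+t≤N 0<t with d ≤? suc t
  ... | yes d≤1+t = shared-<-at e ≤-refl (m+n≤o⇒n≤o 2 2+d≤N) (s≤s⁻¹ d≤1+t) gap
    where
    reorder : ∀ t e → e + (3 + t) ≡ suc (t + suc (suc e))
    reorder = solve-∀
    gap : t + d < e + N
    gap = subst (_≤ e + N) (reorder t e) (+-monoʳ-≤ e 3+t≤N)
  ... | no  d≰1+t = shared-<-at (pred t) (subst (_< d) (sym 1+t′≡t) (<-trans (n<1+n t) (≰⇒> d≰1+t)))
                      (m+n≤o⇒n≤o 2 2+d≤N) (≤-reflexive 1+t′≡t) gap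
    where
    1+t′≡t : suc (pred t) ≡ t
    1+t′≡t = suc-pred t ⦃ >-nonZero 0<t ⦄
    reorder : ∀ h d → h + (2 + d) ≡ suc (suc h + d)
    reorder = solve-∀
    gap : t + d < pred t + N
    gap = subst (λ x → suc (x + d) ≤ pred t + N) 1+t′≡t
            (subst (_≤ pred t + N) (reorder (pred t) d) (+-monoʳ-≤ (pred t) 2+d≤N))

  window-size : ∀ {s} → t < N → s ≤ N → countBelow N (window s) ≡ suc t
  window-size {s} t<N s≤N = begin
    countBelow N (window s)   ≡⟨ countBelow-cong N (λ a _ → ∧-idem (window s a)) ⟨
    cap s s                   ≡⟨ cap-∸ t<N ≤-refl s≤N ⟩
    shared (s ∸ s)           ≡⟨ cong shared (n∸n≡0 s) ⟩
    shared 0                 ≡⟨ shared-0 t<N ⟩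
    suc t                     ∎
    where open ≡-Reasoning

  cap-suc : ∀ {s} → t < N → suc s ≤ N → t ≤ cap s (suc s)
  cap-suc {s} t<N 1+s≤N = begin
    t               ≤⟨ shared-1 t<N ⟩
    shared 1       ≡⟨ cap-rotate s 1 t<N (subst (_≤ N) (+-comm 1 s) 1+s≤N) ⟨
    cap s (s + 1)   ≡⟨ cong (cap s) (+-comm s 1) ⟩
    cap s (suc s)   ∎
    where open ≤-Reasoning

  cap-< : ∀ {s s′} → 2 + t ≤ N → s < s′ → s′ < N → cap s s′ ≤ t
  cap-< {s} {s′} 2+t≤N s<s′ s′<N = begin
    cap s s′             ≡⟨ cap-∸ (m+n≤o⇒n≤o 1 2+t≤N) (<⇒≤ s<s′) (<⇒≤ s′<N) ⟩
    shared (s′ ∸ s)     ≤⟨ shared-≤ (m<n⇒0<n∸m s<s′) (≤-<-trans (m∸n≤m s′ s) s′<N) 2+t≤N ⟩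
    t                    ∎
    where open ≤-Reasoning

  cap-≢ : ∀ {s s′} → 2 + t ≤ N → s < N → s′ < N → s ≢ s′ → cap s s′ ≤ t
  cap-≢ {s} {s′} 2+t≤N s<N s′<N s≢s′ with <-cmp s s′
  ... | tri< s<s′ _ _ = cap-< 2+t≤N s<s′ s′<N
  ... | tri≈ _ s≡s′ _ = ⊥-elim (s≢s′ s≡s′)
  ... | tri> _ _ s′<s = subst (_≤ t) (cap-comm s′ s) (cap-< 2+t≤N s′<s s<N)

  cap-apart : ∀ {s s′} → 3 + t ≤ N → 0 < t → 2 + s ≤ s′ → 2 + s′ ≤ N + s → s′ ≤ N → cap s s′ < t
  cap-apart {s} {s′} 3+t≤N 0<t 2+s≤s′ 2+s′≤N+s s′≤N =
    subst (_< t) (sym (cap-∸ (m+n≤o⇒n≤o 2 3+t≤N) s≤s′ s′≤N)) (shared-< 2≤d 2+d≤N 3+t≤N 0<t)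
    where
    s≤s′ : s ≤ s′
    s≤s′ = m+n≤o⇒n≤o 2 2+s≤s′
    s+d≡s′ : s + (s′ ∸ s) ≡ s′
    s+d≡s′ = m+[n∸m]≡n s≤s′
    reorder : ∀ s d → 2 + (s + d) ≡ s + (2 + d)
    reorder = solve-∀
    2≤d : 2 ≤ s′ ∸ s
    2≤d = +-cancelˡ-≤ s 2 (s′ ∸ s) (subst₂ _≤_ (+-comm 2 s) (sym s+d≡s′) 2+s≤s′)
    2+d≤N : 2 + (s′ ∸ s) ≤ N
    2+d≤N = +-cancelˡ-≤ s (2 + (s′ ∸ s)) N
              (subst₂ _≤_ (trans (cong (2 +_) (sym s+d≡s′)) (reorder s (s′ ∸ s))) (+-comm N s) 2+s′≤N+s)

  -- The last vertex L is cut down to window (L ∸ 1) ∩ window L, which keeps it from sharing t points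
  -- with vertex 0, its neighbour across the wrap-around of ℤ/N.
  arcs : ℕ → ℕ → Bool
  arcs u a = if does (u ℕ.≟ L) then window (pred u) a ∧ window u a else window u a

  arcsCommon : ℕ → ℕ → ℕ
  arcsCommon u w = countBelow N (λ a → arcs u a ∧ arcs w a)

  arcs-⊆ : ∀ u a → T (arcs u a) → T (window u a)
  arcs-⊆ u a with does (u ℕ.≟ L)
  ... | true  = proj₂ ∘ Equivalence.to T-∧
  ... | false = id

  arcs-last-⊆ : ∀ a → T (arcs L a) → T (window (pred L) a)
  arcs-last-⊆ a rewrite dec-true (L ℕ.≟ L) refl = proj₁ ∘ Equivalence.to T-∧

  arcs-≢ : ∀ {u} → u ≢ L → ∀ a → arcs u a ≡ window u a
  arcs-≢ {u} u≢L a rewrite dec-false (u ℕ.≟ L) u≢L = refl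

  arcsCommon-mono : ∀ u w s s′ → (∀ a → T (arcs u a) → T (window s a)) → (∀ a → T (arcs w a) → T (window s′ a)) →
                    arcsCommon u w ≤ cap s s′
  arcsCommon-mono u w s s′ u⊆s w⊆s′ =
    count-mono {N} λ a → Equivalence.from T-∧ ∘ map (u⊆s (toℕ a)) (w⊆s′ (toℕ a)) ∘ Equivalence.to T-∧

  arcsCommon≤cap : ∀ u w → arcsCommon u w ≤ cap u w
  arcsCommon≤cap u w = arcsCommon-mono u w u w (arcs-⊆ u) (arcs-⊆ w)

  arcs-size : ∀ {v} → t < N → suc v < N → countBelow N (arcs v) ≡ suc t
  arcs-size {v} t<N 1+v<N = trans (countBelow-cong N (λ a _ → arcs-≢ (<⇒≢ (s≤s⁻¹ 1+v<N)) a))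
                                  (window-size t<N (<⇒≤ (<-trans (n<1+n v) 1+v<N)))

  arcsCommon-adjacent : ∀ {u} → t < N → suc u < N → t ≤ arcsCommon u (suc u)
  arcsCommon-adjacent {u} t<N 1+u<N = ≤-trans (cap-suc t<N (<⇒≤ 1+u<N)) (count-mono {N} (cover ∘ toℕ))
    where
    cover : ∀ a → T (window u a ∧ window (suc u) a) → T (arcs u a ∧ arcs (suc u) a)
    cover a h = Equivalence.from T-∧ (this , next)
      where
      this : T (arcs u a)
      this = subst T (sym (arcs-≢ (<⇒≢ (s≤s⁻¹ 1+u<N)) a)) (proj₁ (Equivalence.to T-∧ h))
      next : T (arcs (suc u) a)
      next with does (suc u ℕ.≟ L)
      ... | true  = h
      ... | false = proj₂ (Equivalence.to T-∧ h)

  arcsCommon-≢ : ∀ {u w} → 2 + t ≤ N → u < N → w < N → u ≢ w → arcsCommon u w ≤ t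
  arcsCommon-≢ {u} {w} 2+t≤N u<N w<N u≢w = ≤-trans (arcsCommon≤cap u w) (cap-≢ 2+t≤N u<N w<N u≢w)

  arcsCommon-distant : ∀ {u w} → 3 + t ≤ N → 0 < t → suc u < w → w < N → arcsCommon u w < t
  arcsCommon-distant {suc u} {w} 3+t≤N 0<t 2+u≤w w<N =
    ≤-<-trans (arcsCommon≤cap (suc u) w) (cap-apart 3+t≤N 0<t 2+u≤w 2+w≤N+1+u (<⇒≤ w<N))
    where
    2+w≤N+1+u : 2 + w ≤ N + suc u
    2+w≤N+1+u = ≤-trans (s≤s w<N) (subst (suc N ≤_) (sym (+-suc N u)) (s≤s (m≤m+n N u)))
  arcsCommon-distant {zero} {w} 3+t≤N 0<t 2≤w w<N with w ℕ.≟ L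
  ... | no w≢L = ≤-<-trans (arcsCommon≤cap 0 w) (cap-apart 3+t≤N 0<t 2≤w 2+w≤N+0 (<⇒≤ w<N))
    where
    2+w≤N+0 : 2 + w ≤ N + 0
    2+w≤N+0 = subst (2 + w ≤_) (sym (+-identityʳ N)) (s≤s (≤∧≢⇒< (s≤s⁻¹ w<N) w≢L))
  ... | yes refl =
    ≤-<-trans (arcsCommon-mono 0 L 0 (pred L) (arcs-⊆ 0) arcs-last-⊆)
              (cap-apart 3+t≤N 0<t (pred-mono-≤ 3≤L) 2+L′≤N+0 (≤-trans pred[n]≤n (n≤1+n L)))
    where
    3≤L : 3 ≤ L
    3≤L = s≤s⁻¹ (≤-trans (+-monoʳ-≤ 3 0<t) 3+t≤N)
    2+L′≤N+0 : 2 + pred L ≤ N + 0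
    2+L′≤N+0 = ≤-reflexive (trans (cong suc (suc-pred L ⦃ >-nonZero (<-≤-trans z<s 3≤L) ⦄)) (sym (+-identityʳ N)))

  windowArcs : Fin N → Fin N → Bool
  windowArcs u a = arcs (toℕ u) (toℕ a)

  windowArcs-admissible : 3 + t ≤ N → 0 < t → Admissible N t windowArcs
  windowArcs-admissible 3+t≤N 0<t = record
    { interior-size   = λ v (_ , 1+v<N) → arcs-size t<N 1+v<N
    ; adjacent-common = λ u w 1+u≡w → subst (λ x → t ≤ arcsCommon (toℕ u) x) 1+u≡w
                          (arcsCommon-adjacent t<N (subst (_< N) (sym 1+u≡w) (toℕ<n w)))
    ; distant-common  = distant
    ; interior-common = λ v w _ w≢v → arcsCommon-≢ 2+t≤N (toℕ<n v) (toℕ<n w) (w≢v ∘ sym ∘ toℕ-injective)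
    }
    where
    2+t≤N : 2 + t ≤ N
    2+t≤N = m+n≤o⇒n≤o 1 3+t≤N
    t<N : t < N
    t<N = m+n≤o⇒n≤o 1 2+t≤N
    distant : ∀ u w → u ≢ w → suc (toℕ u) ≢ toℕ w → suc (toℕ w) ≢ toℕ u → common windowArcs u w < t
    distant u w u≢w ¬uw ¬wu with <-cmp (toℕ u) (toℕ w)
    ... | tri< u<w _ _ = arcsCommon-distant 3+t≤N 0<t (≤∧≢⇒< u<w ¬uw) (toℕ<n w)
    ... | tri≈ _ u≡w _ = ⊥-elim (u≢w (toℕ-injective u≡w))
    ... | tri> _ _ w<u =
      subst (_< t) (common-comm windowArcs w u) (arcsCommon-distant 3+t≤N 0<t (≤∧≢⇒< w<u ¬wu) (toℕ<n u))

closedNbhd : ∀ {n} → Fin n → Fin n → Bool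
closedNbhd u a = does (toℕ a ≤? suc (toℕ u)) ∧ does (toℕ u ≤? suc (toℕ a))

closedNbhd-admissible : Admissible 4 2 closedNbhd
closedNbhd-admissible = record
  { interior-size   = from-yes (all? {4} λ v → interior? v →-dec count (closedNbhd v) ℕ.≟ 3)
  ; adjacent-common = from-yes (all? {4} λ u → all? {4} λ w →
                        suc (toℕ u) ℕ.≟ toℕ w →-dec 2 ≤? common closedNbhd u w)
  ; distant-common  = from-yes (all? {4} λ u → all? {4} λ w →
                        ¬? (u ≟ w) →-dec ¬? (suc (toℕ u) ℕ.≟ toℕ w) →-dec ¬? (suc (toℕ w) ℕ.≟ toℕ u) →-dec
                        common closedNbhd u w <? 2)
  ; interior-common = from-yes (all? {4} λ v → all? {4} λ w →
                        interior? v →-dec ¬? (w ≟ v) →-dec common closedNbhd v w ≤? 2)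
  }
  where
  interior? : (v : Fin 4) → Dec (Interior 4 (toℕ v))
  interior? v = 0 <? toℕ v ×-dec suc (toℕ v) <? 4

mainTheorem20 : (n t k : ℕ) → 0 < n → 0 < t →
    ((n ≡ 4 × t ≡ 2) ⊎ (4 ≤ n × t + 3 ≤ n)) →
    (att : Fin k → Fin n) → InteriorAttachment n k att →
    IsPCompetitionGraph (t + k) (CatGraph n k att)
mainTheorem20 _       _ k _ _   (inj₁ (refl , refl)) = admissible⇒competition closedNbhd-admissible
mainTheorem20 (suc L) t k _ 0<t (inj₂ (_ , t+3≤n))   =
  admissible⇒competition (windowArcs-admissible (subst (_≤ suc L) (+-comm t 3) t+3≤n) 0<t)
  where open CyclicWindows L t
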